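{- Let $\{F_n\}_{n\ge 0}$ be the Fibonacci sequence ($F_0=0$, $F_1=1$, $F_{n+2}=F_{n+1}+F_n$). For $s\ge 0$ let $\Phi_s=\{\langle j,s\rangle : 1\le j\le F_s\}$, let $V=\bigcup_{p\ge 0}\Phi_p$, and let $P=(V,E)$ be the digraph with arcs $E=\{(\langle j,p\rangle,\langle q,p+1\rangle) : p\ge 0,\ 1\le j\le F_p,\ 1\le q\le F_{p+1}\}$. Define the partial order $\le_P$ on $V$ by $\langle s,t\rangle\le_P\langle u,v\rangle$ iff $t<v$ or ($t=v$ and $s=u$). Define two relations on $V$: $$\langle s,t\rangle\le_X\langle u,v\rangle \iff t<v \ \text{ or }\ (t=v \text{ and } s\le u),$$ $$\langle s,t\rangle\le_Y\langle u,v\rangle \iff t<v \ \text{ or }\ (t=v \text{ and } s\ge u).$$ Then $\le_X$ and $\le_Y$ are linear extensions of $\le_P$, the order $\le_P$ equals their intersection $\le_X\cap\le_Y$ (so $\le_P$ has dimension at most $2$), and the Hasse diagram of $(V,\le_P)$ coincides with the digraph $P$. In particular $P$ is orderable (an oDAG): there exists a poset of dimension $2$ whose Hasse diagram coincides with $P$.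
   Context: The dimension of a partial order $R$ is the least $s$ such that $R$ is the intersection of $s$ linear extensions of $R$; a family of linear orders whose intersection is $R$ is called a realizer of $R$. A directed acyclic graph is called orderable (oDAG) if there exists a poset of dimension $2$ whose Hasse diagram coincides with it. -}

module Defs where

open import Level using (0ℓ)
open import Data.Nat using (ℕ; zero; suc; _+_; _≤_; _<_)
open import Data.Fin using (Fin)
open import Data.Product using (_×_; Σ; ∃-syntax)
open import Data.Sum using (_⊎_)
open import Relation.Nullary using (¬_)
open import Relation.Binary.Core using (Rel)
open import Relation.Binary.Structures using (IsPartialOrder; IsTotalOrder)
open import Relation.Binary.PropositionalEquality using (_≡_)
open import Function.Bundles using (_⇔_)

fib : ℕ → ℕ
fib zero = 0
fib (suc zero) = 1
fib (suc (suc n)) = fib (suc n) + fib n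

record Vtx : Set where
  constructor ⟨_,_⟩[_,_]
  field
    idx   : ℕ
    layer : ℕ
    lo    : 1 ≤ idx
    hi    : idx ≤ fib layer
open Vtx public

Arc : Rel Vtx 0ℓ
Arc x y = layer y ≡ suc (layer x)

_≤P_ : Rel Vtx 0ℓ
x ≤P y = (layer x < layer y) ⊎ (layer x ≡ layer y × idx x ≡ idx y)

_≤X_ : Rel Vtx 0ℓ
x ≤X y = (layer x < layer y) ⊎ (layer x ≡ layer y × idx x ≤ idx y)

_≤Y_ : Rel Vtx 0ℓ
x ≤Y y = (layer x < layer y) ⊎ (layer x ≡ layer y × idx y ≤ idx x)

module _ {A : Set} where

  IsLinearExtension : Rel A 0ℓ → Rel A 0ℓ → Set
  IsLinearExtension R L = IsTotalOrder _≡_ L × (∀ x y → R x y → L x y)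

  Realizer : Rel A 0ℓ → ℕ → Set₁
  Realizer R s = Σ (Fin s → Rel A 0ℓ) λ L →
    (∀ i → IsLinearExtension R (L i)) × (∀ x y → R x y ⇔ (∀ i → L i x y))

  HasDimension : Rel A 0ℓ → ℕ → Set₁
  HasDimension R s = Realizer R s × (∀ t → t < s → ¬ Realizer R t)

  Covers : Rel A 0ℓ → Rel A 0ℓ
  Covers R x y = R x y × ¬ (x ≡ y) ×
    ¬ (∃[ z ] (R x z × ¬ (x ≡ z) × R z y × ¬ (z ≡ y)))

  HasseDiagramIs : Rel A 0ℓ → Rel A 0ℓ → Set
  HasseDiagramIs R E = ∀ x y → Covers R x y ⇔ E x y

  IsODAG : Rel A 0ℓ → Set₁
  IsODAG E = ∃[ R ] (IsPartialOrder _≡_ R × HasDimension R 2 × HasseDiagramIs R E)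

-- All three orders compare vertices lexicographically, first by layer and then
-- by index, the index being compared with =, ≤ and ≥ respectively; since ≤ ∩ ≥
-- is =, we get ≤P = ≤X ∩ ≤Y.  Two distinct vertices of one layer are
-- incomparable in ≤P, so no realizer of size 0 or 1 exists.  A strict ≤P-step
-- raises the layer, and layer p + 1 is never empty (F (p+1) ≥ 1), so x is
-- covered by y exactly when layer y = layer x + 1.
module Submission where

open import Defs
open import Level using (0ℓ)
open import Data.Nat using (ℕ; suc; _≤_; _<_; s≤s; z≤n)
open import Data.Nat.Properties
  using ( ≤-refl; ≤-trans; ≤-reflexive; ≤-irrelevant; ≤-antisym; ≤-isTotalOrder
        ; <-trans; <-irrefl; <-asym; <-cmp; <-≤-trans; m≤m+n; m≤n⇒m<n∨m≡n; 1+n≢n)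
open import Data.Fin using (Fin; zero; suc)
open import Data.Product using (_×_; _,_; proj₁; ∃-syntax)
open import Data.Sum using (_⊎_; inj₁; inj₂)
open import Data.Empty using (⊥-elim)
open import Function using (flip)
open import Function.Bundles using (_⇔_; mk⇔; Equivalence)
open import Relation.Nullary using (¬_)
open import Relation.Binary.Core using (Rel; _⇒_)
open import Relation.Binary.Definitions using (Reflexive; Transitive; Antisymmetric; Total; tri<; tri≈; tri>)
open import Relation.Binary.Structures using (IsPartialOrder; IsTotalOrder)
open import Relation.Binary.PropositionalEquality
  using (_≡_; refl; sym; trans; cong; cong₂; subst; isEquivalence)
import Relation.Binary.PropositionalEquality.Properties as ≡
import Relation.Binary.Construct.Flip.EqAndOrd as Flip

Vtx-≡ : ∀ {x y : Vtx} → idx x ≡ idx y → layer x ≡ layer y → x ≡ y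
Vtx-≡ {⟨ i , p ⟩[ lo₁ , hi₁ ]} {⟨ .i , .p ⟩[ lo₂ , hi₂ ]} refl refl =
  cong₂ ⟨ i , p ⟩[_,_] (≤-irrelevant lo₁ lo₂) (≤-irrelevant hi₁ hi₂)

fib-suc-positive : ∀ n → 1 ≤ fib (suc n)
fib-suc-positive 0       = ≤-refl
fib-suc-positive (suc n) = ≤-trans (fib-suc-positive n) (m≤m+n _ _)

-- The order "lower layer first, then compare indices by R"; ≤P, ≤X and ≤Y are
-- definitionally LayerLex _≡_, LayerLex _≤_ and LayerLex (flip _≤_).
LayerLex : Rel ℕ 0ℓ → Rel Vtx 0ℓ
LayerLex R x y = (layer x < layer y) ⊎ (layer x ≡ layer y × R (idx x) (idx y))

module _ {R : Rel ℕ 0ℓ} where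

  LayerLex-reflexive : Reflexive R → _≡_ ⇒ LayerLex R
  LayerLex-reflexive refl-R refl = inj₂ (refl , refl-R)

  LayerLex-trans : Transitive R → Transitive (LayerLex R)
  LayerLex-trans _      (inj₁ p)       (inj₁ q)        = inj₁ (<-trans p q)
  LayerLex-trans _      (inj₁ p)       (inj₂ (e , _))  = inj₁ (subst (_ <_) e p)
  LayerLex-trans _      (inj₂ (e , _)) (inj₁ q)        = inj₁ (subst (_< _) (sym e) q)
  LayerLex-trans trans-R (inj₂ (e , r)) (inj₂ (e′ , r′)) = inj₂ (trans e e′ , trans-R r r′)

  LayerLex-antisym : Antisymmetric _≡_ R → Antisymmetric _≡_ (LayerLex R)
  LayerLex-antisym _ (inj₁ p)       (inj₁ q)       = ⊥-elim (<-asym p q)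
  LayerLex-antisym _ (inj₁ p)       (inj₂ (e , _)) = ⊥-elim (<-irrefl (sym e) p)
  LayerLex-antisym _ (inj₂ (e , _)) (inj₁ q)       = ⊥-elim (<-irrefl (sym e) q)
  LayerLex-antisym antisym-R (inj₂ (e , r)) (inj₂ (_ , r′)) = Vtx-≡ (antisym-R r r′) e

  LayerLex-total : Total R → Total (LayerLex R)
  LayerLex-total total-R x y with <-cmp (layer x) (layer y)
  ... | tri< x<y _ _ = inj₁ (inj₁ x<y)
  ... | tri> _ _ y<x = inj₂ (inj₁ y<x)
  ... | tri≈ _ e _ with total-R (idx x) (idx y)
  ...   | inj₁ r = inj₁ (inj₂ (e , r))
  ...   | inj₂ r = inj₂ (inj₂ (sym e , r))

  LayerLex-isPartialOrder : IsPartialOrder _≡_ R → IsPartialOrder _≡_ (LayerLex R)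
  LayerLex-isPartialOrder po = record
    { isPreorder = record
      { isEquivalence = isEquivalence
      ; reflexive     = LayerLex-reflexive P.refl
      ; trans         = λ {x} {y} {z} → LayerLex-trans P.trans {x} {y} {z}
      }
    ; antisym = λ {x} {y} → LayerLex-antisym P.antisym {x} {y}
    }
    where module P = IsPartialOrder po

  LayerLex-isTotalOrder : IsTotalOrder _≡_ R → IsTotalOrder _≡_ (LayerLex R)
  LayerLex-isTotalOrder to = record
    { isPartialOrder = LayerLex-isPartialOrder T.isPartialOrder
    ; total          = LayerLex-total T.total
    }
    where module T = IsTotalOrder to

LayerLex-mono : ∀ {R S : Rel ℕ 0ℓ} → R ⇒ S → ∀ x y → LayerLex R x y → LayerLex S x y
LayerLex-mono _   _ _ (inj₁ p)       = inj₁ p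
LayerLex-mono R⇒S _ _ (inj₂ (e , r)) = inj₂ (e , R⇒S r)

LayerLex-∩ : ∀ {R S : Rel ℕ 0ℓ} x y →
             LayerLex R x y → LayerLex S x y → LayerLex (λ i j → R i j × S i j) x y
LayerLex-∩ _ _ (inj₁ p)       _              = inj₁ p
LayerLex-∩ _ _ (inj₂ (e , _)) (inj₁ q)       = ⊥-elim (<-irrefl e q)
LayerLex-∩ _ _ (inj₂ (e , r)) (inj₂ (_ , s)) = inj₂ (e , r , s)

≤P-isPartialOrder : IsPartialOrder _≡_ _≤P_
≤P-isPartialOrder = LayerLex-isPartialOrder ≡.isPartialOrder

≤P⇒≤X : ∀ x y → x ≤P y → x ≤X y
≤P⇒≤X = LayerLex-mono ≤-reflexive

≤P⇒≤Y : ∀ x y → x ≤P y → x ≤Y y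
≤P⇒≤Y = LayerLex-mono (λ i≡j → ≤-reflexive (sym i≡j))

≤X-isLinearExtension : IsLinearExtension _≤P_ _≤X_
≤X-isLinearExtension = LayerLex-isTotalOrder ≤-isTotalOrder , ≤P⇒≤X

≤Y-isLinearExtension : IsLinearExtension _≤P_ _≤Y_
≤Y-isLinearExtension = LayerLex-isTotalOrder (Flip.isTotalOrder ≤-isTotalOrder) , ≤P⇒≤Y

≤X∩≤Y⇒≤P : ∀ x y → x ≤X y → x ≤Y y → x ≤P y
≤X∩≤Y⇒≤P x y x≤Xy x≤Yy =
  LayerLex-mono {λ i j → i ≤ j × j ≤ i} (λ (i≤j , j≤i) → ≤-antisym i≤j j≤i) x y
                (LayerLex-∩ {_≤_} {flip _≤_} x y x≤Xy x≤Yy)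

≤P⇔≤X∩≤Y : ∀ x y → x ≤P y ⇔ (x ≤X y × x ≤Y y)
≤P⇔≤X∩≤Y x y = mk⇔ (λ p → ≤P⇒≤X x y p , ≤P⇒≤Y x y p) (λ (p , q) → ≤X∩≤Y⇒≤P x y p q)

≤P-strict⇒layer< : ∀ {x y} → x ≤P y → ¬ x ≡ y → layer x < layer y
≤P-strict⇒layer< (inj₁ p)       _   = p
≤P-strict⇒layer< (inj₂ (e , i)) x≢y = ⊥-elim (x≢y (Vtx-≡ i e))

first-of-next-layer : Vtx → Vtx
first-of-next-layer x = ⟨ 1 , suc (layer x) ⟩[ ≤-refl , fib-suc-positive (layer x) ]

Covers⇒Arc : ∀ {x y} → Covers _≤P_ x y → Arc x y
Covers⇒Arc {x} {y} (x≤y , x≢y , nothing-between) with m≤n⇒m<n∨m≡n (≤P-strict⇒layer< x≤y x≢y)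
... | inj₂ e      = sym e
... | inj₁ suc<ly = ⊥-elim (nothing-between (z , inj₁ ≤-refl , x≢z , inj₁ suc<ly , z≢y))
  where
  z = first-of-next-layer x
  x≢z : ¬ x ≡ z
  x≢z x≡z = 1+n≢n (sym (cong layer x≡z))
  z≢y : ¬ z ≡ y
  z≢y z≡y = <-irrefl (cong layer z≡y) suc<ly

Arc⇒Covers : ∀ {x y} → Arc x y → Covers _≤P_ x y
Arc⇒Covers {x} {y} arc = inj₁ x<y , x≢y , nothing-between
  where
  x<y : layer x < layer y
  x<y = subst (layer x <_) (sym arc) ≤-refl
  x≢y : ¬ x ≡ y
  x≢y x≡y = <-irrefl (cong layer x≡y) x<y
  nothing-between : ¬ (∃[ z ] (x ≤P z × ¬ x ≡ z × z ≤P y × ¬ z ≡ y))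
  nothing-between (z , x≤z , x≢z , z≤y , z≢y) =
    <-irrefl refl (<-≤-trans (subst (layer z <_) arc (≤P-strict⇒layer< z≤y z≢y))
                             (≤P-strict⇒layer< x≤z x≢z))

hasse-≤P : HasseDiagramIs _≤P_ Arc
hasse-≤P _ _ = mk⇔ Covers⇒Arc Arc⇒Covers

module _ {A : Set} {R : Rel A 0ℓ} {a b : A} (a≰b : ¬ R a b) (b≰a : ¬ R b a) where

  incomparable⇒¬Realizer-0 : ¬ Realizer R 0
  incomparable⇒¬Realizer-0 (_ , _ , realizes) = a≰b (Equivalence.from (realizes a b) (λ ()))

  incomparable⇒¬Realizer-1 : ¬ Realizer R 1
  incomparable⇒¬Realizer-1 (L , linear , realizes)
    with IsTotalOrder.total (proj₁ (linear zero)) a b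
  ... | inj₁ ab = a≰b (Equivalence.from (realizes a b) (λ { zero → ab }))
  ... | inj₂ ba = b≰a (Equivalence.from (realizes b a) (λ { zero → ba }))

  incomparable⇒¬Realizer-<2 : ∀ t → t < 2 → ¬ Realizer R t
  incomparable⇒¬Realizer-<2 0 _ = incomparable⇒¬Realizer-0
  incomparable⇒¬Realizer-<2 1 _ = incomparable⇒¬Realizer-1
  incomparable⇒¬Realizer-<2 (suc (suc _)) (s≤s (s≤s ()))

-- Layer 3 is the first with two vertices (F 3 = 2).
⟨1,3⟩ ⟨2,3⟩ : Vtx
⟨1,3⟩ = ⟨ 1 , 3 ⟩[ ≤-refl , s≤s z≤n ]
⟨2,3⟩ = ⟨ 2 , 3 ⟩[ s≤s z≤n , ≤-refl ]

⟨1,3⟩≰P⟨2,3⟩ : ¬ ⟨1,3⟩ ≤P ⟨2,3⟩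
⟨1,3⟩≰P⟨2,3⟩ (inj₁ 3<3)     = <-irrefl refl 3<3
⟨1,3⟩≰P⟨2,3⟩ (inj₂ (_ , ()))

⟨2,3⟩≰P⟨1,3⟩ : ¬ ⟨2,3⟩ ≤P ⟨1,3⟩
⟨2,3⟩≰P⟨1,3⟩ (inj₁ 3<3)     = <-irrefl refl 3<3
⟨2,3⟩≰P⟨1,3⟩ (inj₂ (_ , ()))

≤X,≤Y : Fin 2 → Rel Vtx 0ℓ
≤X,≤Y zero       = _≤X_
≤X,≤Y (suc zero) = _≤Y_

≤P-realizer : Realizer _≤P_ 2
≤P-realizer = ≤X,≤Y , linear , realizes
  where
  linear : ∀ i → IsLinearExtension _≤P_ (≤X,≤Y i)
  linear zero       = ≤X-isLinearExtension
  linear (suc zero) = ≤Y-isLinearExtension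
  realizes : ∀ x y → x ≤P y ⇔ (∀ i → ≤X,≤Y i x y)
  realizes x y = mk⇔ (λ p → λ { zero → ≤P⇒≤X x y p ; (suc zero) → ≤P⇒≤Y x y p })
                     (λ f → ≤X∩≤Y⇒≤P x y (f zero) (f (suc zero)))

≤P-hasDimension-2 : HasDimension _≤P_ 2
≤P-hasDimension-2 = ≤P-realizer ,
  incomparable⇒¬Realizer-<2 {R = _≤P_} {⟨1,3⟩} {⟨2,3⟩} ⟨1,3⟩≰P⟨2,3⟩ ⟨2,3⟩≰P⟨1,3⟩

mainTheorem2 :
    IsPartialOrder _≡_ _≤P_
    × IsLinearExtension _≤P_ _≤X_
    × IsLinearExtension _≤P_ _≤Y_
    × (∀ x y → x ≤P y ⇔ (x ≤X y × x ≤Y y))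
    × HasseDiagramIs _≤P_ Arc
    × IsODAG Arc
mainTheorem2 =
  ≤P-isPartialOrder , ≤X-isLinearExtension , ≤Y-isLinearExtension , ≤P⇔≤X∩≤Y , hasse-≤P ,
  (_≤P_ , ≤P-isPartialOrder , ≤P-hasDimension-2 , hasse-≤P)
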